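{- Let $\Pi_i$ be any reduced stable partition of an SR instance $I$. Then $\Pi_i$ is the union $M_i\mathcal{O}_I$ of its odd cycles $\mathcal{O}_I$ and a perfect stable matching $M_i$ of the sub-instance $I_E$ of $I$, where $M_i$ is written as a cyclic permutation consisting of transpositions.
   Context: An SR (Stable Roommates) instance $I=(A,\succ)$ consists of an even number $n$ of agents, each with a strict complete preference ranking over all other agents (and ranking itself last). A stable partition is a permutation $\Pi$ of $A$ such that (T1) every agent $a_i$ weakly prefers its successor $\Pi(a_i)$ to its predecessor $\Pi^{ -1}(a_i)$, and (T2) there are no two distinct agents $a_i,a_j$ with $a_j \succ_i \Pi^{ -1}(a_i)$ and $a_i \succ_j \Pi^{ -1}(a_j)$. A stable partition is reduced if all its cycles have length 2 or odd length. The odd-length cycles are the same (invariant) in every stable partition of $I$; denote them by $\mathcal{O}_I$. The sub-instance $I_E=(A',\succ')$ has agent set $A'=A\setminus A(\mathcal{O}_I)$ (the agents not in odd cycles) and $\succ'$ is the restriction of $\succ$ to $A'$. -}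

module Defs where

open import Data.Nat using (ℕ; zero; suc; _<_; _≤_)
open import Data.Nat.Divisibility using (_∣_)
open import Data.Fin using (Fin)
open import Data.Product using (Σ; _×_; _,_; ∃; ∃-syntax)
open import Data.Sum using (_⊎_)
open import Relation.Binary.PropositionalEquality using (_≡_; _≢_)
open import Relation.Nullary using (¬_)
open import Function.Bundles using (_↔_; Inverse)
open import Function using (_∘_)

-- Agent i ranks the agents by  rank i : Fin n → ℕ
-- (smaller = more preferred).
record SRInstance (n : ℕ) : Set where
  field
    rank        : Fin n → Fin n → ℕ
    rank-inj    : ∀ i {j k} → rank i j ≡ rank i k → j ≡ k
    self-last   : ∀ i j → j ≢ i → rank i j < rank i i
open SRInstance public

-- j ≻_i k : agent i strictly prefers j to k
_prefers_over_ : ∀ {n} → (I : SRInstance n) → Fin n → Fin n → Fin n → Set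
(I prefers i over j) k = rank I i j < rank I i k

WeaklyPrefers : ∀ {n} → SRInstance n → Fin n → Fin n → Fin n → Set
WeaklyPrefers I i j k = j ≡ k ⊎ (I prefers i over j) k

-- A permutation of the agents: Π (successor) and its inverse Π⁻¹ (predecessor).
Perm : ℕ → Set
Perm n = Fin n ↔ Fin n

module _ {n : ℕ} (Π : Perm n) where
  open Inverse Π renaming (to to π; from to π⁻¹)

  iter : ℕ → Fin n → Fin n
  iter zero    a = a
  iter (suc k) a = π (iter k a)

  CycleLength : Fin n → ℕ → Set
  CycleLength a k = 0 < k × iter k a ≡ a × (∀ j → 0 < j → j < k → iter j a ≢ a)

  OddNat : ℕ → Set
  OddNat k = ¬ (2 ∣ k)

  InOddCycle : Fin n → Set
  InOddCycle a = ∃[ k ] (CycleLength a k × OddNat k)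

  IsStablePartition : SRInstance n → Set
  IsStablePartition I =
      (∀ i → WeaklyPrefers I i (π i) (π⁻¹ i))
    × (∀ i j → i ≢ j → ¬ ((I prefers i over j) (π⁻¹ i) × (I prefers j over i) (π⁻¹ j)))

  IsReduced : Set
  IsReduced = ∀ a → ∃[ k ] (CycleLength a k × (k ≡ 2 ⊎ OddNat k))

-- Sub-instance given by the agent set A' (a predicate on agents), preferences
-- restricted.  M : Fin n → Fin n is a perfect matching of the sub-instance on A'
-- (values of M outside A' are irrelevant): M maps A' into A', has no fixed
-- points on A' and is an involution on A' (i.e. a product of transpositions).
IsPerfectMatchingOn : ∀ {n} → (Fin n → Set) → (Fin n → Fin n) → Set
IsPerfectMatchingOn A' M =
  ∀ a → A' a → A' (M a) × M a ≢ a × M (M a) ≡ a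

IsStableMatchingOn : ∀ {n} → SRInstance n → (Fin n → Set) → (Fin n → Fin n) → Set
IsStableMatchingOn I A' M =
  ∀ a b → A' a → A' b → a ≢ b →
    ¬ ((I prefers a over b) (M a) × (I prefers b over a) (M b))

{-# OPTIONS --safe #-}
module Submission where

-- An agent outside the odd cycles of a reduced partition lies on a 2-cycle,
-- so there Π is a fixed-point-free involution, i.e. a perfect matching M = Π,
-- and its predecessor coincides with its successor: Π⁻¹ = Π.  Hence (T2) for Π
-- is literally stability of M.  The agents outside odd cycles are closed under Π:
-- if π a lay on a cycle of odd length k, then π² a = a would give
-- π a = πᵏ (π a) = π (π a) = a.

open import Defs
open import Data.Nat using (ℕ; zero; suc; s≤s; z≤n)
open import Data.Nat.Divisibility using (_∣_; _∣0; ∣-refl; ∣m∣n⇒∣m+n)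
open import Data.Fin using (Fin)
open import Data.Product using (Σ; _×_; _,_; proj₁; proj₂)
open import Data.Sum using (inj₁; inj₂)
open import Data.Empty using (⊥-elim)
open import Relation.Binary.PropositionalEquality
open import Relation.Nullary using (¬_; contradiction)
open import Function.Bundles using (Inverse)

module _ {n : ℕ} (Π : Perm n) where
  open Inverse Π renaming (to to π; from to π⁻¹)
  open ≡-Reasoning

  iter-odd-involutive : ∀ {x} → π (π x) ≡ x → ∀ k → ¬ 2 ∣ k → iter Π k x ≡ π x
  iter-odd-involutive ππx≡x zero          odd = contradiction (2 ∣0) odd
  iter-odd-involutive ππx≡x (suc zero)    odd = refl
  iter-odd-involutive {x} ππx≡x (suc (suc k)) odd = begin
    π (π (iter Π k x)) ≡⟨ cong (λ y → π (π y)) (iter-odd-involutive ππx≡x k odd-k) ⟩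
    π (π (π x))        ≡⟨ cong π ππx≡x ⟩
    π x                ∎
    where
    odd-k : ¬ 2 ∣ k
    odd-k 2∣k = odd (∣m∣n⇒∣m+n ∣-refl 2∣k)

  π⁻¹≡π : ∀ {a} → π (π a) ≡ a → π⁻¹ a ≡ π a
  π⁻¹≡π {a} ππa≡a = begin
    π⁻¹ a           ≡⟨ cong π⁻¹ (sym ππa≡a) ⟩
    π⁻¹ (π (π a))   ≡⟨ strictlyInverseʳ (π a) ⟩
    π a             ∎

  module _ (reduced : IsReduced Π) {a : Fin n} (notOdd : ¬ InOddCycle Π a) where

    on-2-cycle-outside-odd : CycleLength Π a 2
    on-2-cycle-outside-odd with reduced a
    ... | k , cycle , inj₂ odd = ⊥-elim (notOdd (k , cycle , odd))
    ... | _ , cycle , inj₁ refl = cycle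

    π-involutive-outside-odd : π (π a) ≡ a
    π-involutive-outside-odd = proj₁ (proj₂ on-2-cycle-outside-odd)

    π-fixpointFree-outside-odd : π a ≢ a
    π-fixpointFree-outside-odd = proj₂ (proj₂ on-2-cycle-outside-odd) 1 (s≤s z≤n) (s≤s (s≤s z≤n))

    π-preserves-outside-odd : ¬ InOddCycle Π (π a)
    π-preserves-outside-odd (k , (_ , πᵏπa≡πa , _) , odd) =
      π-fixpointFree-outside-odd (begin
        π a              ≡⟨ sym πᵏπa≡πa ⟩
        iter Π k (π a)   ≡⟨ iter-odd-involutive (cong π π-involutive-outside-odd) k odd ⟩
        π (π a)          ≡⟨ π-involutive-outside-odd ⟩
        a                ∎)

lemma17 : (n : ℕ) → 2 ∣ n → (I : SRInstance n) → (Π : Perm n) →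
    IsStablePartition Π I → IsReduced Π →
    Σ (Fin n → Fin n) (λ M →
    IsPerfectMatchingOn (λ a → ¬ InOddCycle Π a) M
    × IsStableMatchingOn I (λ a → ¬ InOddCycle Π a) M
    × (∀ a → ¬ InOddCycle Π a → Inverse.to Π a ≡ M a))
lemma17 n _ I Π (_ , no-blocking-pair) reduced = π , perfect , stable , λ _ _ → refl
  where
  open Inverse Π using () renaming (to to π)

  perfect : IsPerfectMatchingOn (λ a → ¬ InOddCycle Π a) π
  perfect a notOdd = π-preserves-outside-odd Π reduced notOdd
                    , π-fixpointFree-outside-odd Π reduced notOdd
                    , π-involutive-outside-odd Π reduced notOdd

  stable : IsStableMatchingOn I (λ a → ¬ InOddCycle Π a) π
  stable a b notOdd-a notOdd-b a≢b (a-prefers-b , b-prefers-a)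
    rewrite sym (π⁻¹≡π Π (π-involutive-outside-odd Π reduced notOdd-a))
          | sym (π⁻¹≡π Π (π-involutive-outside-odd Π reduced notOdd-b))
    = no-blocking-pair a b a≢b (a-prefers-b , b-prefers-a)
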